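{- Let $n,\lambda n$ be positive integers, let $M$ be a uniformly random binary $\lambda n\times n$ matrix, $C=\{x\in\{0,1\}^n: Mx=0\}$ over $\mathbb F_2$, and $p=2^{ -\lambda n}$. For $u\in\{0,1\}^n$ let $Y_u$ be the indicator of the event $u\in C$ and $Z_u=Y_u-p$. Assume $k\le\lambda n-1$ and let $S=(u_1,\dots,u_k)$ be a sequence of vectors in $\{0,1\}^n$, with $r(S)$ the $\mathbb F_2$-rank of $\{u_1,\dots,u_k\}$. Then: (1) if the sequence contains no coloops, $\tfrac12 p^{r(S)}\le \mathbb E_C\prod_{j=1}^k Z_{u_j}\le 2p^{r(S)}$; (2) if the sequence contains a coloop, $\mathbb E_C\prod_{j=1}^k Z_{u_j}=0$.
   Context: A coloop of a sequence $(u_1,\dots,u_k)$ of vectors in $\mathbb F_2^n$ is an entry $u_j$ not contained in the $\mathbb F_2$-span of the remaining entries. $\mathbb E_C$ denotes expectation over the random matrix $M$. -}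

module Defs where

open import Data.Bool using (Bool; true; false; _∧_; _xor_; if_then_else_; not)
open import Data.Nat using (ℕ; zero; suc; _⊔_)
open import Data.Fin using (Fin; zero; suc)
open import Data.Vec using (Vec; []; _∷_; zipWith; replicate; foldr)
open import Data.Vec.Properties using (≡-dec)
open import Data.List using (List; []; _∷_; concatMap; map)
import Data.Bool.Properties as BP
open import Data.Rational using (ℚ; 0ℚ; 1ℚ; ½; _+_; _*_; _-_)
open import Data.Product using (Σ; ∃; _×_)
open import Relation.Binary.PropositionalEquality using (_≡_)
open import Relation.Nullary using (¬_; does)

-- Vectors in F_2^n are Vec Bool n; addition is coordinatewise xor.
_⊕_ : {n : ℕ} → Vec Bool n → Vec Bool n → Vec Bool n
_⊕_ = zipWith _xor_

zeroV : (n : ℕ) → Vec Bool n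
zeroV n = replicate n false

dot : {n : ℕ} → Vec Bool n → Vec Bool n → Bool
dot x y = foldr _ _xor_ false (zipWith _∧_ x y)

lincomb : {n : ℕ} (k : ℕ) → (Fin k → Bool) → (Fin k → Vec Bool n) → Vec Bool n
lincomb {n} zero s u = zeroV n
lincomb (suc k) s u =
  (if s zero then u zero else zeroV _) ⊕ lincomb k (λ i → s (suc i)) (λ i → u (suc i))

allVecsOf : {A : Set} → List A → (m : ℕ) → List (Vec A m)
allVecsOf xs zero = [] ∷ []
allVecsOf xs (suc m) = concatMap (λ x → map (x ∷_) (allVecsOf xs m)) xs

allBits : (n : ℕ) → List (Vec Bool n)
allBits n = allVecsOf (true ∷ false ∷ []) n

allMatrices : (m n : ℕ) → List (Vec (Vec Bool n) m)
allMatrices m n = allVecsOf (allBits n) m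

eqV : {n : ℕ} → Vec Bool n → Vec Bool n → Bool
eqV x y = does (≡-dec BP._≟_ x y)

isZeroV : {n : ℕ} → Vec Bool n → Bool
isZeroV {n} x = eqV x (zeroV n)

anyL : {A : Set} → (A → Bool) → List A → Bool
anyL p [] = false
anyL p (x ∷ xs) = p x Data.Bool.∨ anyL p xs

allL : {A : Set} → (A → Bool) → List A → Bool
allL p xs = not (anyL (λ x → not (p x)) xs)

maxL : List ℕ → ℕ
maxL [] = 0
maxL (x ∷ xs) = x ⊔ maxL xs

count : {k : ℕ} → Vec Bool k → ℕ
count [] = 0
count (true ∷ xs) = suc (count xs)
count (false ∷ xs) = count xs

lookupB : {k : ℕ} → Vec Bool k → Fin k → Bool
lookupB = Data.Vec.lookup

subsetB : {k : ℕ} → Vec Bool k → Vec Bool k → Bool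
subsetB [] [] = true
subsetB (true ∷ t) (false ∷ s) = false
subsetB (_ ∷ t) (_ ∷ s) = subsetB t s

-- The subfamily (u_i)_{i ∈ sel} is linearly independent over F_2:
-- no nonempty sub-selection has zero sum.
independentB : {n : ℕ} (k : ℕ) → (Fin k → Vec Bool n) → Vec Bool k → Bool
independentB k u sel =
  allL (λ t → not (subsetB t sel) Data.Bool.∨ isZeroV t
                Data.Bool.∨ not (isZeroV (lincomb k (lookupB t) u)))
       (allBits k)

rank : {n : ℕ} (k : ℕ) → (Fin k → Vec Bool n) → ℕ
rank k u = maxL (map (λ sel → if independentB k u sel then count sel else 0) (allBits k))

IsColoop : {n : ℕ} (k : ℕ) → (Fin k → Vec Bool n) → Fin k → Set
IsColoop k u j = ¬ (Σ (Fin k → Bool) λ s → (s j ≡ false) × (lincomb k s u ≡ u j))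

HasColoop : {n : ℕ} (k : ℕ) → (Fin k → Vec Bool n) → Set
HasColoop k u = ∃ λ j → IsColoop k u j

powℚ : ℚ → ℕ → ℚ
powℚ q zero = 1ℚ
powℚ q (suc e) = q * powℚ q e

sumℚ : List ℚ → ℚ
sumℚ [] = 0ℚ
sumℚ (x ∷ xs) = x + sumℚ xs

prodℚ : (k : ℕ) → (Fin k → ℚ) → ℚ
prodℚ zero f = 1ℚ
prodℚ (suc k) f = f zero * prodℚ k (λ i → f (suc i))

-- p = 2^{-m}, where m = λn is the number of rows
pr : (m : ℕ) → ℚ
pr m = powℚ ½ m

inCode : {m n : ℕ} → Vec (Vec Bool n) m → Vec Bool n → Bool
inCode M x = allL (λ row → not (dot row x)) (Data.Vec.toList M)

Y : {m n : ℕ} → Vec (Vec Bool n) m → Vec Bool n → ℚ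
Y M u = if inCode M u then 1ℚ else 0ℚ

Z : {m n : ℕ} → Vec (Vec Bool n) m → Vec Bool n → ℚ
Z {m} M u = Y M u - pr m

-- E_C ∏_{j=1}^k Z_{u_j}, with M uniform over all 2^{mn} binary m×n matrices
EprodZ : (m n k : ℕ) → (Fin k → Vec Bool n) → ℚ
EprodZ m n k u =
  sumℚ (map (λ M → prodℚ k (λ j → Z M (u j))) (allMatrices m n)) * powℚ ½ (m Data.Nat.* n)

-- Expanding ∏ⱼ (Y_{uⱼ} − p) over the subsets S of the indices gives
-- E ∏ Z = Σ_S (−p)^{k−|S|} · P(uⱼ ∈ C for all j ∈ S). That event says that every row of M is
-- orthogonal to span{uⱼ : j ∈ S}, a subspace whose orthogonal complement has 2^{n−r(S)} elements,
-- so its probability is p^{r(S)}.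
-- If uⱼ is a coloop, the terms of S and S ∪ {j} cancel: adding j removes a factor −p and, as
-- uⱼ ∉ span S, adds a factor p. Without coloops every S ≠ [k] has (k − |S|) + r(S) ≥ r + 1, since a
-- missing uⱼ is spanned by the other vectors; so the 2^k − 1 terms with S ≠ [k] are at most
-- p^{r+1} in absolute value, and 2^k p ≤ ½ puts the sum between ½ p^r and 2 p^r.

module Submission where

open import Defs
open import Data.Nat using (ℕ; zero; suc; _≤_; _<_; z≤n; s≤s)
import Data.Nat as ℕ
import Data.Nat.Properties as ℕP
open import Data.Fin using (Fin; zero; suc)
open import Data.Vec as Vec using (Vec; []; _∷_; replicate; lookup; _[_]≔_)
import Data.Vec.Properties as VecP
open import Data.Vec.Properties using (≡-dec)
open import Data.Bool using (Bool; true; false; _∧_; _∨_; _xor_; not; if_then_else_)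
import Data.Bool.Properties as BoolP
open import Data.List as List using (List; []; _∷_; _++_)
import Data.List.Properties as ListP
open import Data.List.Membership.Propositional using (_∈_)
open import Data.List.Membership.Propositional.Properties using (∈-map⁺; ∈-++⁺ˡ; ∈-++⁺ʳ)
open import Data.List.Relation.Unary.Any using (here; there)
open import Data.Product using (Σ; _×_; _,_; proj₁; proj₂)
open import Data.Sum using (_⊎_; inj₁; inj₂)
open import Data.Empty using (⊥-elim)
open import Data.Rational using (ℚ; 0ℚ; 1ℚ; ½; _+_; _*_; -_; _-_; NonNegative; nonNegative; positive)
  renaming (_≤_ to _≤ℚ_; _<_ to _<ℚ_)
import Data.Rational.Properties as ℚP
open import Data.Rational.Solver using (module +-*-Solver)
open import Algebra.Bundles using (CommutativeMonoid; CommutativeRing)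
open import Algebra.Properties.CommutativeSemigroup
  (CommutativeRing.+-commutativeSemigroup BoolP.xor-∧-commutativeRing)
  using () renaming (interchange to xor-interchange)
open import Algebra.Properties.CommutativeSemigroup
  (CommutativeMonoid.commutativeSemigroup BoolP.∧-commutativeMonoid)
  using () renaming (x∙yz≈y∙xz to ∧-swap)
open import Algebra.Properties.CommutativeSemigroup
  (CommutativeMonoid.commutativeSemigroup ℚP.+-0-commutativeMonoid)
  using () renaming (interchange to +-interchange)
open import Algebra.Properties.CommutativeSemigroup
  (CommutativeMonoid.commutativeSemigroup ℚP.*-1-commutativeMonoid)
  using () renaming (interchange to *-interchange)
open import Algebra.Properties.CommutativeSemiring.Exp
  (CommutativeRing.commutativeSemiring ℚP.+-*-commutativeRing)
  using (_^_; ^-homo-*; ^-assocʳ; ^-distrib-*)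
open import Relation.Binary.PropositionalEquality
open import Relation.Nullary using (¬_; yes; no)
open import Relation.Nullary.Decidable using (toWitness; dec-true; dec-false)
open import Function using (_∘_)
open +-*-Solver

⊕-assoc : ∀ {n} (x y z : Vec Bool n) → (x ⊕ y) ⊕ z ≡ x ⊕ (y ⊕ z)
⊕-assoc = VecP.zipWith-assoc BoolP.xor-assoc

⊕-comm : ∀ {n} (x y : Vec Bool n) → x ⊕ y ≡ y ⊕ x
⊕-comm = VecP.zipWith-comm BoolP.xor-comm

⊕-identityˡ : ∀ {n} (x : Vec Bool n) → zeroV n ⊕ x ≡ x
⊕-identityˡ = VecP.zipWith-identityˡ BoolP.xor-identityˡ

⊕-identityʳ : ∀ {n} (x : Vec Bool n) → x ⊕ zeroV n ≡ x
⊕-identityʳ = VecP.zipWith-identityʳ BoolP.xor-identityʳ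

⊕-self : ∀ {n} (x : Vec Bool n) → x ⊕ x ≡ zeroV n
⊕-self []      = refl
⊕-self (a ∷ x) = cong₂ _∷_ (BoolP.xor-same a) (⊕-self x)

⊕-cancelˡ : ∀ {n} (x y : Vec Bool n) → x ⊕ (x ⊕ y) ≡ y
⊕-cancelˡ x y = begin
  x ⊕ (x ⊕ y)  ≡⟨ ⊕-assoc x x y ⟨
  (x ⊕ x) ⊕ y  ≡⟨ cong (_⊕ y) (⊕-self x) ⟩
  zeroV _ ⊕ y  ≡⟨ ⊕-identityˡ y ⟩
  y            ∎
  where open ≡-Reasoning

⊕≡zero⇒≡ : ∀ {n} (x y : Vec Bool n) → x ⊕ y ≡ zeroV n → x ≡ y
⊕≡zero⇒≡ x y eq = begin
  x                  ≡⟨ ⊕-cancelˡ y x ⟨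
  y ⊕ (y ⊕ x)        ≡⟨ cong (y ⊕_) (trans (⊕-comm y x) eq) ⟩
  y ⊕ zeroV _        ≡⟨ ⊕-identityʳ y ⟩
  y                  ∎
  where open ≡-Reasoning

dot-distribʳ-⊕ : ∀ {n} (x y w : Vec Bool n) → dot (x ⊕ y) w ≡ dot x w xor dot y w
dot-distribʳ-⊕ []      []      []      = refl
dot-distribʳ-⊕ (a ∷ x) (b ∷ y) (c ∷ w) =
  trans (cong₂ _xor_ (BoolP.∧-distribʳ-xor c a b) (dot-distribʳ-⊕ x y w))
        (xor-interchange (a ∧ c) (b ∧ c) (dot x w) (dot y w))

dot-distribˡ-⊕ : ∀ {n} (x v w : Vec Bool n) → dot x (v ⊕ w) ≡ dot x v xor dot x w
dot-distribˡ-⊕ []      []      []      = refl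
dot-distribˡ-⊕ (a ∷ x) (b ∷ v) (c ∷ w) =
  trans (cong₂ _xor_ (BoolP.∧-distribˡ-xor a b c) (dot-distribˡ-⊕ x v w))
        (xor-interchange (a ∧ b) (a ∧ c) (dot x v) (dot x w))

dot-zeroˡ : ∀ {n} (v : Vec Bool n) → dot (zeroV n) v ≡ false
dot-zeroˡ []      = refl
dot-zeroˡ (a ∷ v) = dot-zeroˡ v

dot-zeroʳ : ∀ {n} (x : Vec Bool n) → dot x (zeroV n) ≡ false
dot-zeroʳ []      = refl
dot-zeroʳ (a ∷ x) = trans (cong (_xor dot x _) (BoolP.∧-zeroʳ a)) (dot-zeroʳ x)

≡zero⊎∃dot≡true : ∀ {n} (v : Vec Bool n) → v ≡ zeroV n ⊎ Σ (Vec Bool n) (λ x → dot x v ≡ true)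
≡zero⊎∃dot≡true []          = inj₁ refl
≡zero⊎∃dot≡true (true ∷ v)  = inj₂ (true ∷ zeroV _ , cong (true xor_) (dot-zeroˡ v))
≡zero⊎∃dot≡true (false ∷ v) with ≡zero⊎∃dot≡true v
... | inj₁ v≡0        = inj₁ (cong (false ∷_) v≡0)
... | inj₂ (x , x·v) = inj₂ (false ∷ x , x·v)

∈-allBits : ∀ {n} (v : Vec Bool n) → v ∈ allBits n
∈-allBits {zero} []          = here refl
∈-allBits {suc n} (true ∷ v)  = ∈-++⁺ˡ (∈-map⁺ (true ∷_) (∈-allBits v))
∈-allBits {suc n} (false ∷ v) =
  ∈-++⁺ʳ (List.map (true ∷_) (allBits n)) (∈-++⁺ˡ (∈-map⁺ (false ∷_) (∈-allBits v)))

anyL-false : ∀ {A : Set} (q : A → Bool) {xs x} → anyL q xs ≡ false → x ∈ xs → q x ≡ false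
anyL-false q {x ∷ xs} none (here refl) = BoolP.∨-conicalˡ (q x) (anyL q xs) none
anyL-false q {x ∷ xs} none (there x∈) = anyL-false q (BoolP.∨-conicalʳ (q x) (anyL q xs) none) x∈

allL-true : ∀ {A : Set} (p : A → Bool) {xs x} → allL p xs ≡ true → x ∈ xs → p x ≡ true
allL-true p all x∈ = BoolP.not-injective (anyL-false (not ∘ p) (BoolP.not-injective all) x∈)

allL-intro : ∀ {A : Set} (p : A → Bool) xs → (∀ x → p x ≡ true) → allL p xs ≡ true
allL-intro p xs every = cong not (none xs)
  where none : ∀ xs → anyL (not ∘ p) xs ≡ false
        none []       = refl
        none (x ∷ xs) rewrite every x = none xs

allL-∷ : ∀ {A : Set} (p : A → Bool) x xs → allL p (x ∷ xs) ≡ p x ∧ allL p xs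
allL-∷ p x xs with p x
... | true  = refl
... | false = refl

maxL-≤ : ∀ {A : Set} (h : A → ℕ) xs {r} → (∀ x → h x ≤ r) → maxL (List.map h xs) ≤ r
maxL-≤ h []       h≤r = z≤n
maxL-≤ h (x ∷ xs) h≤r = ℕP.⊔-lub (h≤r x) (maxL-≤ h xs h≤r)

maxL-≥ : ∀ {A : Set} (h : A → ℕ) {xs x} → x ∈ xs → h x ≤ maxL (List.map h xs)
maxL-≥ h {x ∷ xs} (here refl) = ℕP.m≤m⊔n (h x) _
maxL-≥ h {y ∷ xs} (there x∈)  = ℕP.≤-trans (maxL-≥ h x∈) (ℕP.m≤n⊔m (h y) _)

isZeroV-true : ∀ {n} (v : Vec Bool n) → isZeroV v ≡ true → v ≡ zeroV n
isZeroV-true {n} v v≟0 with ≡-dec BoolP._≟_ v (zeroV n)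
... | yes v≡0 = v≡0
... | no _ with () ← v≟0

isZeroV-false : ∀ {n} (v : Vec Bool n) → v ≢ zeroV n → isZeroV v ≡ false
isZeroV-false {n} v v≢0 = dec-false (≡-dec BoolP._≟_ v (zeroV n)) v≢0

isZeroV-zero : ∀ n → isZeroV (zeroV n) ≡ true
isZeroV-zero n = dec-true (≡-dec BoolP._≟_ (zeroV n) (zeroV n)) refl

two : ℚ
two = 1ℚ + 1ℚ

0≤1 : 0ℚ ≤ℚ 1ℚ
0≤1 = toWitness {a? = 0ℚ ℚP.≤? 1ℚ} _

0<½ : 0ℚ <ℚ ½
0<½ = toWitness {a? = 0ℚ ℚP.<? ½} _

½<1 : ½ <ℚ 1ℚ
½<1 = toWitness {a? = ½ ℚP.<? 1ℚ} _

𝟙 : Bool → ℚ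
𝟙 true  = 1ℚ
𝟙 false = 0ℚ

𝟙-mono : ∀ {b c} → (b ≡ true → c ≡ true) → 𝟙 b ≤ℚ 𝟙 c
𝟙-mono {false} {false} _   = ℚP.≤-refl
𝟙-mono {false} {true}  _   = 0≤1
𝟙-mono {true}  {true}  _   = ℚP.≤-refl
𝟙-mono {true}  {false} b⇒c with () ← b⇒c refl

𝟙-∧ : ∀ a b → 𝟙 (a ∧ b) ≡ 𝟙 a * 𝟙 b
𝟙-∧ true  b = sym (ℚP.*-identityˡ (𝟙 b))
𝟙-∧ false b = sym (ℚP.*-zeroˡ (𝟙 b))

∑ : {A : Set} → List A → (A → ℚ) → ℚ
∑ xs g = sumℚ (List.map g xs)

∑-++ : ∀ {A : Set} (xs ys : List A) g → ∑ (xs ++ ys) g ≡ ∑ xs g + ∑ ys g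
∑-++ []       ys g = sym (ℚP.+-identityˡ _)
∑-++ (x ∷ xs) ys g = trans (cong (g x +_) (∑-++ xs ys g)) (sym (ℚP.+-assoc (g x) _ _))

∑-map : ∀ {A B : Set} (f : A → B) xs g → ∑ (List.map f xs) g ≡ ∑ xs (g ∘ f)
∑-map f []       g = refl
∑-map f (x ∷ xs) g = cong (g (f x) +_) (∑-map f xs g)

∑-concatMap : ∀ {A B : Set} (f : A → List B) xs g →
              ∑ (List.concatMap f xs) g ≡ ∑ xs (λ x → ∑ (f x) g)
∑-concatMap f []       g = refl
∑-concatMap f (x ∷ xs) g =
  trans (∑-++ (f x) (List.concatMap f xs) g) (cong (∑ (f x) g +_) (∑-concatMap f xs g))

∑-cong : ∀ {A : Set} (xs : List A) {g h : A → ℚ} → (∀ x → g x ≡ h x) → ∑ xs g ≡ ∑ xs h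
∑-cong []       g≡h = refl
∑-cong (x ∷ xs) g≡h = cong₂ _+_ (g≡h x) (∑-cong xs g≡h)

∑-+ : ∀ {A : Set} (xs : List A) g h → ∑ xs (λ x → g x + h x) ≡ ∑ xs g + ∑ xs h
∑-+ []       g h = refl
∑-+ (x ∷ xs) g h = trans (cong (g x + h x +_) (∑-+ xs g h)) (+-interchange (g x) (h x) (∑ xs g) (∑ xs h))

∑-*ˡ : ∀ {A : Set} (xs : List A) c g → ∑ xs (λ x → c * g x) ≡ c * ∑ xs g
∑-*ˡ []       c g = sym (ℚP.*-zeroʳ c)
∑-*ˡ (x ∷ xs) c g = trans (cong (c * g x +_) (∑-*ˡ xs c g)) (sym (ℚP.*-distribˡ-+ c (g x) _))

∑-*ʳ : ∀ {A : Set} (xs : List A) c g → ∑ xs (λ x → g x * c) ≡ ∑ xs g * c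
∑-*ʳ xs c g = trans (∑-cong xs (λ x → ℚP.*-comm (g x) c)) (trans (∑-*ˡ xs c g) (ℚP.*-comm c _))

∑-mono : ∀ {A : Set} (xs : List A) {g h : A → ℚ} → (∀ x → g x ≤ℚ h x) → ∑ xs g ≤ℚ ∑ xs h
∑-mono []       g≤h = ℚP.≤-refl
∑-mono (x ∷ xs) g≤h = ℚP.+-mono-≤ (g≤h x) (∑-mono xs g≤h)

∑-allBits-suc : ∀ n g → ∑ (allBits (suc n)) g ≡
                ∑ (allBits n) (λ x → g (true ∷ x)) + ∑ (allBits n) (λ x → g (false ∷ x))
∑-allBits-suc n g = begin
  ∑ (List.map (true ∷_) A ++ (List.map (false ∷_) A ++ [])) g
    ≡⟨ ∑-++ (List.map (true ∷_) A) _ g ⟩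
  ∑ (List.map (true ∷_) A) g + ∑ (List.map (false ∷_) A ++ []) g
    ≡⟨ cong₂ _+_ (∑-map (true ∷_) A g)
                 (trans (∑-++ (List.map (false ∷_) A) [] g)
                        (trans (ℚP.+-identityʳ _) (∑-map (false ∷_) A g))) ⟩
  ∑ A (λ x → g (true ∷ x)) + ∑ A (λ x → g (false ∷ x)) ∎
  where open ≡-Reasoning
        A : List (Vec Bool n)
        A = allBits n

∑-allBits-translate : ∀ n (y : Vec Bool n) g → ∑ (allBits n) g ≡ ∑ (allBits n) (λ x → g (x ⊕ y))
∑-allBits-translate zero    []      g = refl
∑-allBits-translate (suc n) (b ∷ y) g = begin
  ∑ (allBits (suc n)) g
    ≡⟨ ∑-allBits-suc n g ⟩
  ∑ A (λ x → g (true ∷ x)) + ∑ A (λ x → g (false ∷ x))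
    ≡⟨ cong₂ _+_ (∑-allBits-translate n y _) (∑-allBits-translate n y _) ⟩
  ∑ A (λ x → g (true ∷ (x ⊕ y))) + ∑ A (λ x → g (false ∷ (x ⊕ y)))
    ≡⟨ swap-if b ⟩
  ∑ A (λ x → g ((true xor b) ∷ (x ⊕ y))) + ∑ A (λ x → g ((false xor b) ∷ (x ⊕ y)))
    ≡⟨ ∑-allBits-suc n (λ x → g (x ⊕ (b ∷ y))) ⟨
  ∑ (allBits (suc n)) (λ x → g (x ⊕ (b ∷ y))) ∎
  where
    open ≡-Reasoning
    A : List (Vec Bool n)
    A = allBits n
    swap-if : ∀ b → ∑ A (λ x → g (true ∷ (x ⊕ y))) + ∑ A (λ x → g (false ∷ (x ⊕ y))) ≡
                    ∑ A (λ x → g ((true xor b) ∷ (x ⊕ y))) + ∑ A (λ x → g ((false xor b) ∷ (x ⊕ y)))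
    swap-if true  = ℚP.+-comm (∑ A (λ x → g (true ∷ (x ⊕ y)))) _
    swap-if false = refl

∑-allBits-1 : ∀ n → ∑ (allBits n) (λ _ → 1ℚ) ≡ powℚ two n
∑-allBits-1 zero    = refl
∑-allBits-1 (suc n) = trans (∑-allBits-suc n (λ _ → 1ℚ))
  (trans (cong₂ _+_ (∑-allBits-1 n) (∑-allBits-1 n))
         (solve 1 (λ a → a :+ a := (con 1ℚ :+ con 1ℚ) :* a) refl (powℚ two n)))

∑-allVecsOf-multiplicative : ∀ {X : Set} (xs : List X) (g : ∀ {m} → Vec X m → ℚ) (h : X → ℚ) →
  g [] ≡ 1ℚ → (∀ {m} x (v : Vec X m) → g (x ∷ v) ≡ h x * g v) →
  ∀ m → ∑ (allVecsOf xs m) g ≡ powℚ (∑ xs h) m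
∑-allVecsOf-multiplicative xs g h g[] g∷ zero    = trans (ℚP.+-identityʳ _) g[]
∑-allVecsOf-multiplicative {X} xs g h g[] g∷ (suc m) = begin
  ∑ (List.concatMap (λ x → List.map (x ∷_) V) xs) g   ≡⟨ ∑-concatMap _ xs g ⟩
  ∑ xs (λ x → ∑ (List.map (x ∷_) V) g)                 ≡⟨ ∑-cong xs row-sum ⟩
  ∑ xs (λ x → h x * powℚ (∑ xs h) m)                   ≡⟨ ∑-*ʳ xs _ h ⟩
  ∑ xs h * powℚ (∑ xs h) m                             ∎
  where
    open ≡-Reasoning
    V : List (Vec X m)
    V = allVecsOf xs m
    row-sum : ∀ x → ∑ (List.map (x ∷_) V) g ≡ h x * powℚ (∑ xs h) m
    row-sum x = begin
      ∑ (List.map (x ∷_) V) g        ≡⟨ ∑-map (x ∷_) V g ⟩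
      ∑ V (λ v → g (x ∷ v))          ≡⟨ ∑-cong V (g∷ x) ⟩
      ∑ V (λ v → h x * g v)          ≡⟨ ∑-*ˡ V (h x) g ⟩
      h x * ∑ V g                    ≡⟨ cong (h x *_) (∑-allVecsOf-multiplicative xs g h g[] g∷ m) ⟩
      h x * powℚ (∑ xs h) m          ∎

powℚ≡^ : ∀ q n → powℚ q n ≡ q ^ n
powℚ≡^ q zero    = refl
powℚ≡^ q (suc n) = cong (q *_) (powℚ≡^ q n)

powℚ-+ : ∀ q i j → powℚ q (i ℕ.+ j) ≡ powℚ q i * powℚ q j
powℚ-+ q i j rewrite powℚ≡^ q (i ℕ.+ j) | powℚ≡^ q i | powℚ≡^ q j = ^-homo-* q i j

powℚ-* : ∀ q i j → powℚ (powℚ q i) j ≡ powℚ q (i ℕ.* j)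
powℚ-* q i j rewrite powℚ≡^ q i | powℚ≡^ (q ^ i) j | powℚ≡^ q (i ℕ.* j) = ^-assocʳ q i j

powℚ-distrib-* : ∀ x y n → powℚ (x * y) n ≡ powℚ x n * powℚ y n
powℚ-distrib-* x y n rewrite powℚ≡^ (x * y) n | powℚ≡^ x n | powℚ≡^ y n = ^-distrib-* x y n

powℚ-swap : ∀ q i j → powℚ (powℚ q i) j ≡ powℚ (powℚ q j) i
powℚ-swap q i j = trans (powℚ-* q i j) (trans (cong (powℚ q) (ℕP.*-comm i j)) (sym (powℚ-* q j i)))

powℚ-½*two : ∀ n → powℚ ½ n * powℚ two n ≡ 1ℚ
powℚ-½*two zero    = refl
powℚ-½*two (suc n) = trans
  (solve 2 (λ a b → (con ½ :* a) :* ((con 1ℚ :+ con 1ℚ) :* b) := a :* b) refl (powℚ ½ n) (powℚ two n))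
  (powℚ-½*two n)

powℚ-neg : ∀ q e → powℚ (- q) e ≡ powℚ q e ⊎ powℚ (- q) e ≡ - powℚ q e
powℚ-neg q zero    = inj₁ refl
powℚ-neg q (suc e) with powℚ-neg q e
... | inj₁ eq = inj₂ (trans (cong (- q *_) eq) (sym (ℚP.neg-distribˡ-* q _)))
... | inj₂ eq = inj₁ (trans (cong (- q *_) eq) (solve 2 (λ q x → :- q :* (:- x) := q :* x) refl q (powℚ q e)))

±-within : ∀ {x y ε} → 0ℚ ≤ℚ x → x ≤ℚ ε → y ≡ x ⊎ y ≡ - x → - ε ≤ℚ y × y ≤ℚ ε
±-within {x} {ε = ε} 0≤x x≤ε (inj₁ refl) =
  ℚP.≤-trans (ℚP.neg-antimono-≤ (ℚP.≤-trans 0≤x x≤ε)) 0≤x , x≤ε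
±-within {x} {ε = ε} 0≤x x≤ε (inj₂ refl) =
  ℚP.neg-antimono-≤ x≤ε , ℚP.≤-trans (ℚP.neg-antimono-≤ 0≤x) (ℚP.≤-trans 0≤x x≤ε)

module _ {q : ℚ} (0≤q : 0ℚ ≤ℚ q) (q≤1 : q ≤ℚ 1ℚ) where

  private instance
    q-nonNeg : NonNegative q
    q-nonNeg = nonNegative 0≤q

  powℚ-nonNeg : ∀ a → 0ℚ ≤ℚ powℚ q a
  powℚ-nonNeg zero    = 0≤1
  powℚ-nonNeg (suc a) = subst (_≤ℚ q * powℚ q a) (ℚP.*-zeroʳ q) (ℚP.*-monoˡ-≤-nonNeg q (powℚ-nonNeg a))

  powℚ-≤1 : ∀ a → powℚ q a ≤ℚ 1ℚ
  powℚ-≤1 zero    = ℚP.≤-refl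
  powℚ-≤1 (suc a) = ℚP.≤-trans (ℚP.*-monoˡ-≤-nonNeg q (powℚ-≤1 a)) (subst (_≤ℚ 1ℚ) (sym (ℚP.*-identityʳ q)) q≤1)

  powℚ-antitone : ∀ {a b} → a ≤ b → powℚ q b ≤ℚ powℚ q a
  powℚ-antitone {a} {b} a≤b = begin
    powℚ q b                         ≡⟨ cong (powℚ q) (ℕP.m+[n∸m]≡n a≤b) ⟨
    powℚ q (a ℕ.+ (b ℕ.∸ a))        ≡⟨ powℚ-+ q a (b ℕ.∸ a) ⟩
    powℚ q a * powℚ q (b ℕ.∸ a)     ≤⟨ ℚP.*-monoˡ-≤-nonNeg (powℚ q a) {{nonNegative (powℚ-nonNeg a)}}
                                                           (powℚ-≤1 (b ℕ.∸ a)) ⟩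
    powℚ q a * 1ℚ                    ≡⟨ ℚP.*-identityʳ _ ⟩
    powℚ q a                         ∎
    where open ℚP.≤-Reasoning

module _ {q : ℚ} (0<q : 0ℚ <ℚ q) (q<1 : q <ℚ 1ℚ) where

  powℚ-pos : ∀ a → 0ℚ <ℚ powℚ q a
  powℚ-pos zero    = toWitness {a? = 0ℚ ℚP.<? 1ℚ} _
  powℚ-pos (suc a) = subst (_<ℚ q * powℚ q a) (ℚP.*-zeroʳ q)
                       (ℚP.*-monoʳ-<-pos q {{positive 0<q}} (powℚ-pos a))

  powℚ-cancel-≤ : ∀ {a b} → powℚ q b ≤ℚ powℚ q a → a ≤ b
  powℚ-cancel-≤ {a} {b} qᵇ≤qᵃ = ℕP.≮⇒≥ λ b<a → ℚP.<-irrefl refl (begin-strict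
    powℚ q a          ≤⟨ powℚ-antitone (ℚP.<⇒≤ 0<q) (ℚP.<⇒≤ q<1) b<a ⟩
    q * powℚ q b      <⟨ ℚP.*-monoˡ-<-pos (powℚ q b) {{positive (powℚ-pos b)}} q<1 ⟩
    1ℚ * powℚ q b     ≡⟨ ℚP.*-identityˡ _ ⟩
    powℚ q b          ≤⟨ qᵇ≤qᵃ ⟩
    powℚ q a          ∎)
    where open ℚP.≤-Reasoning

-- Orthogonal complements and dimension

module _ {n : ℕ} where

  orth : List (Vec Bool n) → Vec Bool n → Bool
  orth []      x = true
  orth (w ∷ W) x = not (dot x w) ∧ orth W x

  data InSpan : List (Vec Bool n) → Vec Bool n → Set where
    span-[] : InSpan [] (zeroV n)
    span-skip : ∀ {W v} w → InSpan W v → InSpan (w ∷ W) v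
    span-take : ∀ {W v} w → InSpan W v → InSpan (w ∷ W) (w ⊕ v)

  Separable : List (Vec Bool n) → Vec Bool n → Set
  Separable W v = Σ (Vec Bool n) λ x → orth W x ≡ true × dot x v ≡ true

  orth-∷ : ∀ w W x → dot x w ≡ false → orth W x ≡ true → orth (w ∷ W) x ≡ true
  orth-∷ w W x x·w≡0 x⊥W rewrite x·w≡0 = x⊥W

  orth-∷⁻ : ∀ w W x → orth (w ∷ W) x ≡ true → dot x w ≡ false × orth W x ≡ true
  orth-∷⁻ w W x x⊥ = BoolP.not-injective (BoolP.∧-conicalˡ (not (dot x w)) (orth W x) x⊥)
                   , BoolP.∧-conicalʳ (not (dot x w)) (orth W x) x⊥

  orth-inSpan : ∀ {W v} x → orth W x ≡ true → InSpan W v → dot x v ≡ false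
  orth-inSpan x x⊥W span-[]              = dot-zeroʳ x
  orth-inSpan x x⊥W (span-skip {W} w v∈) = orth-inSpan x (proj₂ (orth-∷⁻ w W x x⊥W)) v∈
  orth-inSpan x x⊥W (span-take {W} {v} w v∈) with orth-∷⁻ w W x x⊥W
  ... | x·w≡0 , x⊥W′ = begin
    dot x (w ⊕ v)          ≡⟨ dot-distribˡ-⊕ x w v ⟩
    dot x w xor dot x v    ≡⟨ cong₂ _xor_ x·w≡0 (orth-inSpan x x⊥W′ v∈) ⟩
    false                  ∎
    where open ≡-Reasoning

  separable⇒∉span : ∀ {W v} → Separable W v → ¬ InSpan W v
  separable⇒∉span (x , x⊥W , x·v) v∈ = BoolP.not-¬ refl (trans (sym x·v) (orth-inSpan x x⊥W v∈))

  orth-translate : ∀ W x y → orth W y ≡ true → orth W (x ⊕ y) ≡ orth W x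
  orth-translate []      x y y⊥W = refl
  orth-translate (w ∷ W) x y y⊥W with orth-∷⁻ w W y y⊥W
  ... | y·w≡0 , y⊥W′ = cong₂ (λ b c → not b ∧ c)
    (trans (dot-distribʳ-⊕ x y w) (trans (cong (dot x w xor_) y·w≡0) (BoolP.xor-identityʳ _)))
    (orth-translate W x y y⊥W′)

  separable-∷ : ∀ W w v {x y} → orth W x ≡ true → dot x w ≡ true → dot x v ≡ true →
                orth W y ≡ true → dot y (w ⊕ v) ≡ true → Separable (w ∷ W) v
  separable-∷ W w v {x} {y} x⊥W x·w x·v y⊥W y·w⊕v with dot y w in y·w
  ... | false = y , orth-∷ w W y y·w y⊥W , y·v
    where y·v : dot y v ≡ true
          y·v = trans (cong (_xor dot y v) (sym y·w)) (trans (sym (dot-distribˡ-⊕ y w v)) y·w⊕v)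
  ... | true = x ⊕ y , orth-∷ w W (x ⊕ y) x⊕y·w (trans (orth-translate W x y y⊥W) x⊥W) , x⊕y·v
    where
      y·v : dot y v ≡ false
      y·v = BoolP.not-injective
        (trans (cong (_xor dot y v) (sym y·w)) (trans (sym (dot-distribˡ-⊕ y w v)) y·w⊕v))
      x⊕y·w : dot (x ⊕ y) w ≡ false
      x⊕y·w = trans (dot-distribʳ-⊕ x y w) (cong₂ _xor_ x·w y·w)
      x⊕y·v : dot (x ⊕ y) v ≡ true
      x⊕y·v = trans (dot-distribʳ-⊕ x y v) (cong₂ _xor_ x·v y·v)

  inSpan⊎separable : ∀ W v → InSpan W v ⊎ Separable W v
  inSpan⊎separable [] v with ≡zero⊎∃dot≡true v
  ... | inj₁ refl          = inj₁ span-[]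
  ... | inj₂ (x , x·v)     = inj₂ (x , refl , x·v)
  inSpan⊎separable (w ∷ W) v with inSpan⊎separable W v
  ... | inj₁ v∈ = inj₁ (span-skip w v∈)
  ... | inj₂ (x , x⊥W , x·v) with dot x w in x·w
  ...   | false = inj₂ (x , orth-∷ w W x x·w x⊥W , x·v)
  ...   | true with inSpan⊎separable W (w ⊕ v)
  ...     | inj₁ w⊕v∈            = inj₁ (subst (InSpan (w ∷ W)) (⊕-cancelˡ w v) (span-take w w⊕v∈))
  ...     | inj₂ (y , y⊥W , y·w⊕v) = inj₂ (separable-∷ W w v x⊥W x·w x·v y⊥W y·w⊕v)

  #⊥ : List (Vec Bool n) → ℚ
  #⊥ W = ∑ (allBits n) (λ x → 𝟙 (orth W x))

  -- Translation by a separating vector exchanges {x ⊥ W : x·v = 0} and {x ⊥ W : x·v = 1}.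
  #⊥-separable : ∀ W v → Separable W v → #⊥ (v ∷ W) + #⊥ (v ∷ W) ≡ #⊥ W
  #⊥-separable W v (x₀ , x₀⊥W , x₀·v) = sym (begin
    #⊥ W
      ≡⟨ ∑-cong A (λ x → 𝟙-split (dot x v) (orth W x)) ⟩
    ∑ A (λ x → 𝟙 (not (dot x v) ∧ orth W x) + 𝟙 (dot x v ∧ orth W x))
      ≡⟨ ∑-+ A _ _ ⟩
    #⊥ (v ∷ W) + ∑ A (λ x → 𝟙 (dot x v ∧ orth W x))
      ≡⟨ cong (#⊥ (v ∷ W) +_) (∑-allBits-translate n x₀ _) ⟩
    #⊥ (v ∷ W) + ∑ A (λ x → 𝟙 (dot (x ⊕ x₀) v ∧ orth W (x ⊕ x₀)))
      ≡⟨ cong (#⊥ (v ∷ W) +_) (∑-cong A (λ x → cong 𝟙 (cong₂ _∧_ (x₀-flips x) (orth-translate W x x₀ x₀⊥W)))) ⟩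
    #⊥ (v ∷ W) + #⊥ (v ∷ W) ∎)
    where
      open ≡-Reasoning
      A : List (Vec Bool n)
      A = allBits n
      𝟙-split : ∀ a b → 𝟙 b ≡ 𝟙 (not a ∧ b) + 𝟙 (a ∧ b)
      𝟙-split true  true  = refl
      𝟙-split true  false = refl
      𝟙-split false true  = refl
      𝟙-split false false = refl
      x₀-flips : ∀ (x : Vec Bool n) → dot (x ⊕ x₀) v ≡ not (dot x v)
      x₀-flips x = trans (dot-distribʳ-⊕ x x₀ v)
                     (trans (cong (dot x v xor_) x₀·v) (BoolP.xor-comm (dot x v) true))

  orth-∷-inSpan : ∀ (W : List (Vec Bool n)) v x → InSpan W v → orth (v ∷ W) x ≡ orth W x
  orth-∷-inSpan W v x v∈ with orth W x in x⊥W
  ... | true  = cong (λ b → not b ∧ true) (orth-inSpan x x⊥W v∈)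
  ... | false = BoolP.∧-zeroʳ _

  -- dim span W, computed greedily
  ρ : List (Vec Bool n) → ℕ
  ρ []      = 0
  ρ (v ∷ W) with inSpan⊎separable W v
  ... | inj₁ _ = ρ W
  ... | inj₂ _ = suc (ρ W)

  density : ∀ W → powℚ ½ n * #⊥ W ≡ powℚ ½ (ρ W)
  density [] = trans (cong (powℚ ½ n *_) (∑-allBits-1 n)) (powℚ-½*two n)
  density (v ∷ W) with inSpan⊎separable W v
  ... | inj₁ v∈  = trans (cong (powℚ ½ n *_) (∑-cong (allBits n) (λ x → cong 𝟙 (orth-∷-inSpan W v x v∈))))
                         (density W)
  ... | inj₂ sep = sym (begin
    ½ * powℚ ½ (ρ W)                              ≡⟨ cong (½ *_) (density W) ⟨
    ½ * (powℚ ½ n * #⊥ W)                         ≡⟨ cong (λ c → ½ * (powℚ ½ n * c)) (#⊥-separable W v sep) ⟨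
    ½ * (powℚ ½ n * (#⊥ (v ∷ W) + #⊥ (v ∷ W)))   ≡⟨ solve 2 (λ h c → con ½ :* (h :* (c :+ c)) := h :* c) refl
                                                           (powℚ ½ n) (#⊥ (v ∷ W)) ⟩
    powℚ ½ n * #⊥ (v ∷ W)                         ∎)
    where open ≡-Reasoning

  ρ-inSpan : ∀ W v → InSpan W v → ρ (v ∷ W) ≡ ρ W
  ρ-inSpan W v v∈ with inSpan⊎separable W v
  ... | inj₁ _   = refl
  ... | inj₂ sep = ⊥-elim (separable⇒∉span sep v∈)

  ρ-∉span : ∀ W v → ¬ InSpan W v → ρ (v ∷ W) ≡ suc (ρ W)
  ρ-∉span W v v∉ with inSpan⊎separable W v
  ... | inj₁ v∈ = ⊥-elim (v∉ v∈)
  ... | inj₂ _  = refl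

  ρ-∷-≤ : ∀ W v → ρ (v ∷ W) ≤ suc (ρ W)
  ρ-∷-≤ W v with inSpan⊎separable W v
  ... | inj₁ _ = ℕP.n≤1+n _
  ... | inj₂ _ = ℕP.≤-refl

  ρ-antitone : ∀ W W′ → (∀ x → orth W′ x ≡ true → orth W x ≡ true) → ρ W ≤ ρ W′
  ρ-antitone W W′ ⊥W′⊆⊥W = powℚ-cancel-≤ 0<½ ½<1 (begin
    powℚ ½ (ρ W′)           ≡⟨ density W′ ⟨
    powℚ ½ n * #⊥ W′        ≤⟨ ℚP.*-monoˡ-≤-nonNeg (powℚ ½ n)
                                 {{nonNegative (powℚ-nonNeg (ℚP.<⇒≤ 0<½) (ℚP.<⇒≤ ½<1) n)}}
                                 (∑-mono (allBits n) (λ x → 𝟙-mono (⊥W′⊆⊥W x))) ⟩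
    powℚ ½ n * #⊥ W         ≡⟨ density W ⟩
    powℚ ½ (ρ W)            ∎)
    where open ℚP.≤-Reasoning

  ρ-cong : ∀ W W′ → (∀ x → orth W x ≡ orth W′ x) → ρ W ≡ ρ W′
  ρ-cong W W′ ⊥W≡⊥W′ = ℕP.≤-antisym
    (ρ-antitone W W′ (λ x → trans (⊥W≡⊥W′ x)))
    (ρ-antitone W′ W (λ x → trans (sym (⊥W≡⊥W′ x))))

-- Subfamilies of a sequence of vectors

sel : ∀ {n k} → Vec Bool k → (Fin k → Vec Bool n) → List (Vec Bool n)
sel []          u = []
sel (true ∷ s)  u = u zero ∷ sel s (u ∘ suc)
sel (false ∷ s) u = sel s (u ∘ suc)

full : ∀ k → Vec Bool k
full k = replicate k true

#false : ∀ {k} → Vec Bool k → ℕ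
#false []          = 0
#false (true ∷ s)  = #false s
#false (false ∷ s) = suc (#false s)

subsetB-lookup : ∀ {k} (t s : Vec Bool k) → subsetB t s ≡ true →
                 ∀ i → lookup t i ≡ true → lookup s i ≡ true
subsetB-lookup (true ∷ t)  (true ∷ s)  t⊆s zero    _    = refl
subsetB-lookup (true ∷ t)  (true ∷ s)  t⊆s (suc i) tᵢ   = subsetB-lookup t s t⊆s i tᵢ
subsetB-lookup (false ∷ t) (true ∷ s)  t⊆s (suc i) tᵢ   = subsetB-lookup t s t⊆s i tᵢ
subsetB-lookup (false ∷ t) (false ∷ s) t⊆s (suc i) tᵢ   = subsetB-lookup t s t⊆s i tᵢ

subsetB-full : ∀ {k} (s : Vec Bool k) → subsetB s (full k) ≡ true
subsetB-full []          = refl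
subsetB-full (true ∷ s)  = subsetB-full s
subsetB-full (false ∷ s) = subsetB-full s

#false-insert : ∀ {k} (s : Vec Bool k) j → lookup s j ≡ false → #false s ≡ suc (#false (s [ j ]≔ true))
#false-insert (false ∷ s) zero    _  = refl
#false-insert (true ∷ s)  (suc j) sⱼ = #false-insert s j sⱼ
#false-insert (false ∷ s) (suc j) sⱼ = cong suc (#false-insert s j sⱼ)

≢full⇒∃false : ∀ {k} (s : Vec Bool k) → s ≢ full k → Σ (Fin k) λ j → lookup s j ≡ false
≢full⇒∃false []          s≢full = ⊥-elim (s≢full refl)
≢full⇒∃false (false ∷ s) _      = zero , refl
≢full⇒∃false (true ∷ s)  s≢full with ≢full⇒∃false s (s≢full ∘ cong (true ∷_))
... | j , sⱼ = suc j , sⱼ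

allBut : ∀ {k} → Fin k → Vec Bool k
allBut {k} j = full k [ j ]≔ false

#false-full : ∀ k → #false (full k) ≡ 0
#false-full zero    = refl
#false-full (suc k) = #false-full k

#false-allBut : ∀ {k} (j : Fin k) → #false (allBut j) ≡ 1
#false-allBut {suc k} zero    = cong suc (#false-full k)
#false-allBut {suc k} (suc j) = #false-allBut j

subsetB-allBut : ∀ {k} (s : Vec Bool k) j → lookup s j ≡ false → subsetB s (allBut j) ≡ true
subsetB-allBut (false ∷ s) zero    _  = subsetB-full s
subsetB-allBut (true ∷ s)  (suc j) sⱼ = subsetB-allBut s j sⱼ
subsetB-allBut (false ∷ s) (suc j) sⱼ = subsetB-allBut s j sⱼ

allBut-insert : ∀ {k} (j : Fin k) → allBut j [ j ]≔ true ≡ full k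
allBut-insert {k} j = begin
  (full k [ j ]≔ false) [ j ]≔ true      ≡⟨ VecP.[]≔-idempotent (full k) j ⟩
  full k [ j ]≔ true                     ≡⟨ cong (full k [ j ]≔_) (VecP.lookup-replicate j true) ⟨
  full k [ j ]≔ lookup (full k) j        ≡⟨ VecP.[]≔-lookup (full k) j ⟩
  full k                                 ∎
  where open ≡-Reasoning

lookup-allBut : ∀ {k} (i j : Fin k) → i ≢ j → lookup (allBut j) i ≡ true
lookup-allBut {k} i j i≢j = trans (VecP.lookup∘update′ i≢j (full k) false) (VecP.lookup-replicate i true)

module _ {n : ℕ} where

  inSpan-lincomb : ∀ k (s : Vec Bool k) (t : Fin k → Bool) (u : Fin k → Vec Bool n) →
                   (∀ i → t i ≡ true → lookup s i ≡ true) → InSpan (sel s u) (lincomb k t u)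
  inSpan-lincomb zero    []      t u t⊆s = span-[]
  inSpan-lincomb (suc k) (b ∷ s) t u t⊆s with t zero | b | t⊆s zero
  ... | true  | true  | _ = span-take (u zero) (inSpan-lincomb k s (t ∘ suc) (u ∘ suc) (t⊆s ∘ suc))
  ... | true  | false | s₀ with () ← s₀ refl
  ... | false | true  | _ = subst (InSpan _) (sym (⊕-identityˡ _))
                              (span-skip (u zero) (inSpan-lincomb k s (t ∘ suc) (u ∘ suc) (t⊆s ∘ suc)))
  ... | false | false | _ = subst (InSpan _) (sym (⊕-identityˡ _))
                              (inSpan-lincomb k s (t ∘ suc) (u ∘ suc) (t⊆s ∘ suc))

  inSpan⇒lincomb : ∀ k (s : Vec Bool k) (u : Fin k → Vec Bool n) {v} → InSpan (sel s u) v →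
                   Σ (Vec Bool k) λ t → subsetB t s ≡ true × lincomb k (lookup t) u ≡ v
  inSpan⇒lincomb zero    []          u span-[] = [] , refl , refl
  inSpan⇒lincomb (suc k) (true ∷ s)  u (span-skip _ v∈) with inSpan⇒lincomb k s (u ∘ suc) v∈
  ... | t , t⊆s , t·u≡v = false ∷ t , t⊆s , trans (⊕-identityˡ _) t·u≡v
  inSpan⇒lincomb (suc k) (true ∷ s)  u (span-take _ v∈) with inSpan⇒lincomb k s (u ∘ suc) v∈
  ... | t , t⊆s , t·u≡v = true ∷ t , t⊆s , cong (u zero ⊕_) t·u≡v
  inSpan⇒lincomb (suc k) (false ∷ s) u v∈ with inSpan⇒lincomb k s (u ∘ suc) v∈
  ... | t , t⊆s , t·u≡v = false ∷ t , t⊆s , trans (⊕-identityˡ _) t·u≡v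

  orth-sel-insert : ∀ k (s : Vec Bool k) (u : Fin k → Vec Bool n) j → lookup s j ≡ false →
                    ∀ x → orth (sel (s [ j ]≔ true) u) x ≡ orth (u j ∷ sel s u) x
  orth-sel-insert (suc k) (false ∷ s) u zero    _   x = refl
  orth-sel-insert (suc k) (true ∷ s)  u (suc j) sⱼ x =
    trans (cong (not (dot x (u zero)) ∧_) (orth-sel-insert k s (u ∘ suc) j sⱼ x))
          (∧-swap (not (dot x (u zero))) (not (dot x (u (suc j)))) _)
  orth-sel-insert (suc k) (false ∷ s) u (suc j) sⱼ x = orth-sel-insert k s (u ∘ suc) j sⱼ x

  orth-sel-⊆ : ∀ k (s s′ : Vec Bool k) (u : Fin k → Vec Bool n) → subsetB s s′ ≡ true →
               ∀ x → orth (sel s′ u) x ≡ true → orth (sel s u) x ≡ true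
  orth-sel-⊆ zero    []          []           u _    x _ = refl
  orth-sel-⊆ (suc k) (true ∷ s)  (true ∷ s′)  u s⊆s′ x x⊥ with orth-∷⁻ (u zero) (sel s′ (u ∘ suc)) x x⊥
  ... | x·u₀ , x⊥′ = orth-∷ (u zero) (sel s (u ∘ suc)) x x·u₀ (orth-sel-⊆ k s s′ (u ∘ suc) s⊆s′ x x⊥′)
  orth-sel-⊆ (suc k) (false ∷ s) (true ∷ s′)  u s⊆s′ x x⊥ =
    orth-sel-⊆ k s s′ (u ∘ suc) s⊆s′ x (proj₂ (orth-∷⁻ (u zero) (sel s′ (u ∘ suc)) x x⊥))
  orth-sel-⊆ (suc k) (false ∷ s) (false ∷ s′) u s⊆s′ x x⊥ = orth-sel-⊆ k s s′ (u ∘ suc) s⊆s′ x x⊥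

  ρ-sel-mono : ∀ k (s s′ : Vec Bool k) (u : Fin k → Vec Bool n) → subsetB s s′ ≡ true →
               ρ (sel s u) ≤ ρ (sel s′ u)
  ρ-sel-mono k s s′ u s⊆s′ = ρ-antitone (sel s u) (sel s′ u) (orth-sel-⊆ k s s′ u s⊆s′)

  orth-++-∷ : ∀ (E L : List (Vec Bool n)) v x → orth (E ++ v ∷ L) x ≡ orth (v ∷ E ++ L) x
  orth-++-∷ []      L v x = refl
  orth-++-∷ (w ∷ E) L v x = trans (cong (not (dot x w) ∧_) (orth-++-∷ E L v x))
                                  (∧-swap (not (dot x w)) (not (dot x v)) (orth (E ++ L) x))

  ρ-++-∷ : ∀ E L v → ρ (E ++ v ∷ L) ≡ ρ (v ∷ E ++ L)
  ρ-++-∷ E L v = ρ-cong (E ++ v ∷ L) (v ∷ E ++ L) (orth-++-∷ E L v)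

  -- E holds the vectors already passed, so that a dropped vector can be moved to the front.
  ρ-sel-⊆ : ∀ k E (s s′ : Vec Bool k) (u : Fin k → Vec Bool n) → subsetB s s′ ≡ true →
            ρ (E ++ sel s′ u) ℕ.+ #false s′ ≤ ρ (E ++ sel s u) ℕ.+ #false s
  ρ-sel-⊆ zero    E []          []           u _    = ℕP.≤-refl
  ρ-sel-⊆ (suc k) E (true ∷ s)  (true ∷ s′)  u s⊆s′ =
    subst₂ (λ W W′ → ρ W ℕ.+ #false s′ ≤ ρ W′ ℕ.+ #false s)
      (ListP.++-assoc E (u zero ∷ []) (sel s′ (u ∘ suc)))
      (ListP.++-assoc E (u zero ∷ []) (sel s (u ∘ suc)))
      (ρ-sel-⊆ k (E ++ u zero ∷ []) s s′ (u ∘ suc) s⊆s′)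
  ρ-sel-⊆ (suc k) E (false ∷ s) (false ∷ s′) u s⊆s′ =
    subst₂ _≤_ (sym (ℕP.+-suc _ _)) (sym (ℕP.+-suc _ _)) (s≤s (ρ-sel-⊆ k E s s′ (u ∘ suc) s⊆s′))
  ρ-sel-⊆ (suc k) E (false ∷ s) (true ∷ s′)  u s⊆s′ = begin
    ρ (E ++ u₀ ∷ sel s′ (u ∘ suc)) ℕ.+ #false s′
      ≡⟨ cong (λ W → ρ W ℕ.+ #false s′) (ListP.++-assoc E (u₀ ∷ []) _) ⟨
    ρ ((E ++ u₀ ∷ []) ++ sel s′ (u ∘ suc)) ℕ.+ #false s′
      ≤⟨ ρ-sel-⊆ k (E ++ u₀ ∷ []) s s′ (u ∘ suc) s⊆s′ ⟩
    ρ ((E ++ u₀ ∷ []) ++ sel s (u ∘ suc)) ℕ.+ #false s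
      ≡⟨ cong (λ W → ρ W ℕ.+ #false s) (ListP.++-assoc E (u₀ ∷ []) _) ⟩
    ρ (E ++ u₀ ∷ sel s (u ∘ suc)) ℕ.+ #false s
      ≡⟨ cong (ℕ._+ #false s) (ρ-++-∷ E (sel s (u ∘ suc)) u₀) ⟩
    ρ (u₀ ∷ E ++ sel s (u ∘ suc)) ℕ.+ #false s
      ≤⟨ ℕP.+-monoˡ-≤ (#false s) (ρ-∷-≤ (E ++ sel s (u ∘ suc)) u₀) ⟩
    suc (ρ (E ++ sel s (u ∘ suc))) ℕ.+ #false s
      ≡⟨ ℕP.+-suc _ _ ⟨
    ρ (E ++ sel s (u ∘ suc)) ℕ.+ suc (#false s) ∎
    where open ℕP.≤-Reasoning
          u₀ : Vec Bool n
          u₀ = u zero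

  coloop⇒∉span : ∀ k (u : Fin k → Vec Bool n) j → IsColoop k u j →
                 ∀ s → lookup s j ≡ false → ¬ InSpan (sel s u) (u j)
  coloop⇒∉span k u j coloop s sⱼ uⱼ∈ with inSpan⇒lincomb k s u uⱼ∈
  ... | t , t⊆s , t·u≡uⱼ with lookup t j in tⱼ
  ...   | true  = BoolP.not-¬ refl (trans (sym (subsetB-lookup t s t⊆s j tⱼ)) sⱼ)
  ...   | false = coloop (lookup t , tⱼ , t·u≡uⱼ)

  ¬coloop⇒inSpan : ∀ k (u : Fin k → Vec Bool n) j → ¬ IsColoop k u j → InSpan (sel (allBut j) u) (u j)
  ¬coloop⇒inSpan k u j ¬coloop with inSpan⊎separable (sel (allBut j) u) (u j)
  ... | inj₁ uⱼ∈ = uⱼ∈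
  ... | inj₂ sep = ⊥-elim (¬coloop λ (t , tⱼ , t·u≡uⱼ) →
    separable⇒∉span sep (subst (InSpan _) t·u≡uⱼ (inSpan-lincomb k (allBut j) t u (t⊆allBut t tⱼ))))
    where
      t⊆allBut : ∀ t → t j ≡ false → ∀ i → t i ≡ true → lookup (allBut j) i ≡ true
      t⊆allBut t tⱼ i tᵢ = lookup-allBut i j λ { refl → BoolP.not-¬ refl (trans (sym tᵢ) tⱼ) }

  -- Without coloops, dropping one index j ∉ s from the full family keeps the rank, and
  -- each further dropped index lowers it by at most one.
  rank-deficit : ∀ k (u : Fin k → Vec Bool n) → ¬ HasColoop k u → ∀ s → s ≢ full k →
                 suc (ρ (sel (full k) u)) ≤ ρ (sel s u) ℕ.+ #false s
  rank-deficit k u no-coloop s s≢full with ≢full⇒∃false s s≢full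
  ... | j , sⱼ = begin
    suc (ρ (sel (full k) u))          ≡⟨ cong suc ρ-full≡ρ-allBut ⟩
    suc (ρ (sel (allBut j) u))        ≡⟨ ℕP.+-comm 1 _ ⟩
    ρ (sel (allBut j) u) ℕ.+ 1         ≡⟨ cong (ρ (sel (allBut j) u) ℕ.+_) (#false-allBut j) ⟨
    ρ (sel (allBut j) u) ℕ.+ #false (allBut j) ≤⟨ ρ-sel-⊆ k [] s (allBut j) u (subsetB-allBut s j sⱼ) ⟩
    ρ (sel s u) ℕ.+ #false s           ∎
    where
      open ℕP.≤-Reasoning
      ρ-full≡ρ-allBut : ρ (sel (full k) u) ≡ ρ (sel (allBut j) u)
      ρ-full≡ρ-allBut = begin-equality
        ρ (sel (full k) u)                       ≡⟨ cong (λ s → ρ (sel s u)) (allBut-insert j) ⟨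
        ρ (sel (allBut j [ j ]≔ true) u)
          ≡⟨ ρ-cong (sel (allBut j [ j ]≔ true) u) (u j ∷ sel (allBut j) u)
                    (orth-sel-insert k (allBut j) u j (VecP.lookup∘update j (full k) false)) ⟩
        ρ (u j ∷ sel (allBut j) u)
          ≡⟨ ρ-inSpan (sel (allBut j) u) (u j) (¬coloop⇒inSpan k u j (no-coloop ∘ (j ,_))) ⟩
        ρ (sel (allBut j) u)                     ∎

  Independent : ∀ k → (Fin k → Vec Bool n) → Vec Bool k → Set
  Independent k u s = ∀ t → subsetB t s ≡ true → t ≢ zeroV k → lincomb k (lookup t) u ≢ zeroV n

  independentB⇒Independent : ∀ k u s → independentB k u s ≡ true → Independent k u s
  independentB⇒Independent k u s indep t t⊆s t≢0 t·u≡0 =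
    BoolP.not-¬ refl (trans (sym (allL-true _ indep (∈-allBits t))) violated)
    where
      violated : not (subsetB t s) ∨ isZeroV t ∨ not (isZeroV (lincomb k (lookupB t) u)) ≡ false
      violated = cong₂ _∨_ (cong not t⊆s)
                   (cong₂ _∨_ (isZeroV-false t t≢0) (cong not (trans (cong isZeroV t·u≡0) (isZeroV-zero n))))

  Independent⇒independentB : ∀ k u s → Independent k u s → independentB k u s ≡ true
  Independent⇒independentB k u s indep = allL-intro _ (allBits k) holds
    where
      holds : ∀ t → not (subsetB t s) ∨ isZeroV t ∨ not (isZeroV (lincomb k (lookupB t) u)) ≡ true
      holds t with subsetB t s in t⊆s | isZeroV t in t≟0 | isZeroV (lincomb k (lookupB t) u) in t·u≟0
      ... | false | _     | _     = refl
      ... | true  | true  | _     = refl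
      ... | true  | false | false = refl
      ... | true  | false | true  = ⊥-elim (indep t t⊆s
              (λ t≡0 → BoolP.not-¬ refl (trans (sym (isZeroV-zero k)) (trans (cong isZeroV (sym t≡0)) t≟0)))
              (isZeroV-true _ t·u≟0))

  Independent-tail : ∀ k u b s → Independent (suc k) u (b ∷ s) → Independent k (u ∘ suc) s
  Independent-tail k u b s indep t t⊆s t≢0 t·u≡0 =
    indep (false ∷ t) t⊆s (t≢0 ∘ VecP.∷-injectiveʳ) (trans (⊕-identityˡ _) t·u≡0)

  ρ-independent : ∀ k u s → Independent k u s → ρ (sel s u) ≡ count s
  ρ-independent zero    u []          indep = refl
  ρ-independent (suc k) u (false ∷ s) indep = ρ-independent k (u ∘ suc) s (Independent-tail k u false s indep)
  ρ-independent (suc k) u (true ∷ s)  indep =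
    trans (ρ-∉span (sel s (u ∘ suc)) (u zero) u₀∉)
          (cong suc (ρ-independent k (u ∘ suc) s (Independent-tail k u true s indep)))
    where
      u₀∉ : ¬ InSpan (sel s (u ∘ suc)) (u zero)
      u₀∉ u₀∈ with inSpan⇒lincomb k s (u ∘ suc) u₀∈
      ... | t , t⊆s , t·u≡u₀ = indep (true ∷ t) t⊆s (λ ()) (trans (cong (u zero ⊕_) t·u≡u₀) (⊕-self (u zero)))

  greedy : ∀ k → (Fin k → Vec Bool n) → Vec Bool k
  greedy zero    u = []
  greedy (suc k) u with inSpan⊎separable (sel (greedy k (u ∘ suc)) (u ∘ suc)) (u zero)
  ... | inj₁ _ = false ∷ greedy k (u ∘ suc)
  ... | inj₂ _ = true ∷ greedy k (u ∘ suc)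

  orth-greedy : ∀ k u x → orth (sel (greedy k u) u) x ≡ orth (sel (full k) u) x
  orth-greedy zero    u x = refl
  orth-greedy (suc k) u x with inSpan⊎separable (sel (greedy k (u ∘ suc)) (u ∘ suc)) (u zero)
  ... | inj₁ u₀∈ = trans (sym (orth-∷-inSpan _ (u zero) x u₀∈))
                         (cong (not (dot x (u zero)) ∧_) (orth-greedy k (u ∘ suc) x))
  ... | inj₂ _   = cong (not (dot x (u zero)) ∧_) (orth-greedy k (u ∘ suc) x)

  greedy-independent : ∀ k u → Independent k u (greedy k u)
  greedy-independent zero    u []      _   t≢0 = ⊥-elim (t≢0 refl)
  greedy-independent (suc k) u (b ∷ t) t⊆g t≢0
    with inSpan⊎separable (sel (greedy k (u ∘ suc)) (u ∘ suc)) (u zero) | b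
  ... | inj₁ _   | false =
    greedy-independent k (u ∘ suc) t t⊆g (t≢0 ∘ cong (false ∷_)) ∘ trans (sym (⊕-identityˡ _))
  ... | inj₂ _   | false =
    greedy-independent k (u ∘ suc) t t⊆g (t≢0 ∘ cong (false ∷_)) ∘ trans (sym (⊕-identityˡ _))
  ... | inj₂ sep | true  = λ t·u≡0 → separable⇒∉span sep
    (subst (InSpan _) (sym (⊕≡zero⇒≡ (u zero) _ t·u≡0))
           (inSpan-lincomb k (greedy k (u ∘ suc)) (lookup t) (u ∘ suc) (subsetB-lookup t _ t⊆g)))

rank≡ρ : ∀ {n} k (u : Fin k → Vec Bool n) → rank k u ≡ ρ (sel (full k) u)
rank≡ρ k u = ℕP.≤-antisym (maxL-≤ size (allBits k) size≤) (begin
    ρ (sel (full k) u)       ≡⟨ ρ-cong (sel (greedy k u) u) (sel (full k) u) (orth-greedy k u) ⟨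
    ρ (sel (greedy k u) u)   ≡⟨ ρ-independent k u _ (greedy-independent k u) ⟩
    count (greedy k u)       ≡⟨ size-greedy ⟨
    size (greedy k u)        ≤⟨ maxL-≥ size (∈-allBits (greedy k u)) ⟩
    rank k u                 ∎)
  where
    open ℕP.≤-Reasoning
    size : Vec Bool k → ℕ
    size s = if independentB k u s then count s else 0
    size≤ : ∀ s → size s ≤ ρ (sel (full k) u)
    size≤ s with independentB k u s in indep
    ... | true  = subst (_≤ ρ (sel (full k) u)) (ρ-independent k u s (independentB⇒Independent k u s indep))
                        (ρ-sel-mono k s (full k) u (subsetB-full s))
    ... | false = z≤n
    size-greedy : size (greedy k u) ≡ count (greedy k u)
    size-greedy rewrite Independent⇒independentB k u (greedy k u) (greedy-independent k u) = refl

-- Sums over subsets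

sumSubsets : ∀ k → (Vec Bool k → ℚ) → ℚ
sumSubsets zero    F = F []
sumSubsets (suc k) F = sumSubsets k (λ s → F (true ∷ s)) + sumSubsets k (λ s → F (false ∷ s))

sumSubsets-cong : ∀ k {F G : Vec Bool k → ℚ} → (∀ s → F s ≡ G s) → sumSubsets k F ≡ sumSubsets k G
sumSubsets-cong zero    F≡G = F≡G []
sumSubsets-cong (suc k) F≡G =
  cong₂ _+_ (sumSubsets-cong k (F≡G ∘ (true ∷_))) (sumSubsets-cong k (F≡G ∘ (false ∷_)))

sumSubsets-mono : ∀ k {F G : Vec Bool k → ℚ} → (∀ s → F s ≤ℚ G s) → sumSubsets k F ≤ℚ sumSubsets k G
sumSubsets-mono zero    F≤G = F≤G []
sumSubsets-mono (suc k) F≤G =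
  ℚP.+-mono-≤ (sumSubsets-mono k (F≤G ∘ (true ∷_))) (sumSubsets-mono k (F≤G ∘ (false ∷_)))

sumSubsets-const : ∀ k c → sumSubsets k (λ _ → c) ≡ powℚ two k * c
sumSubsets-const zero    c = sym (ℚP.*-identityˡ c)
sumSubsets-const (suc k) c = trans (cong₂ _+_ (sumSubsets-const k c) (sumSubsets-const k c))
  (solve 2 (λ t c → t :* c :+ t :* c := ((con 1ℚ :+ con 1ℚ) :* t) :* c) refl (powℚ two k) c)

sumSubsets-+ : ∀ k (F G : Vec Bool k → ℚ) →
               sumSubsets k (λ s → F s + G s) ≡ sumSubsets k F + sumSubsets k G
sumSubsets-+ zero    F G = refl
sumSubsets-+ (suc k) F G = trans
  (cong₂ _+_ (sumSubsets-+ k (F ∘ (true ∷_)) (G ∘ (true ∷_))) (sumSubsets-+ k (F ∘ (false ∷_)) (G ∘ (false ∷_))))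
  (+-interchange (sumSubsets k (F ∘ (true ∷_))) (sumSubsets k (G ∘ (true ∷_)))
                 (sumSubsets k (F ∘ (false ∷_))) (sumSubsets k (G ∘ (false ∷_))))

sumSubsets-*ˡ : ∀ k c (F : Vec Bool k → ℚ) → sumSubsets k (λ s → c * F s) ≡ c * sumSubsets k F
sumSubsets-*ˡ zero    c F = refl
sumSubsets-*ˡ (suc k) c F = trans
  (cong₂ _+_ (sumSubsets-*ˡ k c (F ∘ (true ∷_))) (sumSubsets-*ˡ k c (F ∘ (false ∷_))))
  (sym (ℚP.*-distribˡ-+ c _ _))

sumSubsets-*ʳ : ∀ k c (F : Vec Bool k → ℚ) → sumSubsets k (λ s → F s * c) ≡ sumSubsets k F * c
sumSubsets-*ʳ k c F = trans (sumSubsets-cong k (λ s → ℚP.*-comm (F s) c))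
                            (trans (sumSubsets-*ˡ k c F) (ℚP.*-comm c _))

∑-sumSubsets : ∀ {A : Set} (xs : List A) k (G : A → Vec Bool k → ℚ) →
               ∑ xs (λ x → sumSubsets k (G x)) ≡ sumSubsets k (λ s → ∑ xs (λ x → G x s))
∑-sumSubsets xs zero    G = refl
∑-sumSubsets xs (suc k) G = trans (∑-+ xs _ _)
  (cong₂ _+_ (∑-sumSubsets xs k (λ x s → G x (true ∷ s))) (∑-sumSubsets xs k (λ x s → G x (false ∷ s))))

sumSubsets-pairing : ∀ k (j : Fin k) (F : Vec Bool k → ℚ) →
  (∀ s → lookup s j ≡ false → F s + F (s [ j ]≔ true) ≡ 0ℚ) → sumSubsets k F ≡ 0ℚ
sumSubsets-pairing (suc k) zero    F cancels = begin
  sumSubsets k (λ s → F (true ∷ s)) + sumSubsets k (λ s → F (false ∷ s))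
    ≡⟨ ℚP.+-comm (sumSubsets k (λ s → F (true ∷ s))) _ ⟩
  sumSubsets k (λ s → F (false ∷ s)) + sumSubsets k (λ s → F (true ∷ s))
    ≡⟨ sumSubsets-+ k (λ s → F (false ∷ s)) (λ s → F (true ∷ s)) ⟨
  sumSubsets k (λ s → F (false ∷ s) + F (true ∷ s))
    ≡⟨ sumSubsets-cong k (λ s → cancels (false ∷ s) refl) ⟩
  sumSubsets k (λ _ → 0ℚ)
    ≡⟨ sumSubsets-const k 0ℚ ⟩
  powℚ two k * 0ℚ
    ≡⟨ ℚP.*-zeroʳ (powℚ two k) ⟩
  0ℚ ∎
  where open ≡-Reasoning
sumSubsets-pairing (suc k) (suc j) F cancels =
  trans (cong₂ _+_ (sumSubsets-pairing k j (λ s → F (true ∷ s)) (cancels ∘ (true ∷_)))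
                   (sumSubsets-pairing k j (λ s → F (false ∷ s)) (cancels ∘ (false ∷_))))
        (ℚP.+-identityʳ 0ℚ)

sumSubsets-near-full : ∀ k (F : Vec Bool k → ℚ) {ε} → 0ℚ ≤ℚ ε → (∀ s → s ≢ full k → - ε ≤ℚ F s × F s ≤ℚ ε) →
  F (full k) - powℚ two k * ε ≤ℚ sumSubsets k F × sumSubsets k F ≤ℚ F (full k) + powℚ two k * ε
sumSubsets-near-full zero F {ε} 0≤ε _ =
    ℚP.≤-trans (ℚP.+-monoʳ-≤ (F []) (ℚP.neg-antimono-≤ 0≤1ε)) (ℚP.≤-reflexive (ℚP.+-identityʳ (F [])))
  , ℚP.≤-trans (ℚP.≤-reflexive (sym (ℚP.+-identityʳ (F [])))) (ℚP.+-monoʳ-≤ (F []) 0≤1ε)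
  where 0≤1ε : 0ℚ ≤ℚ 1ℚ * ε
        0≤1ε = subst (0ℚ ≤ℚ_) (sym (ℚP.*-identityˡ ε)) 0≤ε
sumSubsets-near-full (suc k) F {ε} 0≤ε off-full with sumSubsets-near-full k (F ∘ (true ∷_)) 0≤ε
                                                   (λ s s≢full → off-full (true ∷ s) (s≢full ∘ VecP.∷-injectiveʳ))
... | lo , hi =
    subst (_≤ℚ sumSubsets (suc k) F)
          (solve 3 (λ f t e → (f :- t :* e) :+ (:- (t :* e)) := f :- ((con 1ℚ :+ con 1ℚ) :* t) :* e) refl
                 (F (full (suc k))) (powℚ two k) ε)
          (ℚP.+-mono-≤ lo rest-lo)
  , subst (sumSubsets (suc k) F ≤ℚ_)
          (solve 3 (λ f t e → (f :+ t :* e) :+ t :* e := f :+ ((con 1ℚ :+ con 1ℚ) :* t) :* e) refl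
                 (F (full (suc k))) (powℚ two k) ε)
          (ℚP.+-mono-≤ hi rest-hi)
  where
    rest : Vec Bool k → ℚ
    rest s = F (false ∷ s)
    rest-lo : - (powℚ two k * ε) ≤ℚ sumSubsets k rest
    rest-lo = subst (_≤ℚ sumSubsets k rest)
                    (trans (sumSubsets-const k (- ε)) (sym (ℚP.neg-distribʳ-* (powℚ two k) ε)))
                    (sumSubsets-mono k (λ s → proj₁ (off-full (false ∷ s) λ ())))
    rest-hi : sumSubsets k rest ≤ℚ powℚ two k * ε
    rest-hi = subst (sumSubsets k rest ≤ℚ_) (sumSubsets-const k ε)
                    (sumSubsets-mono k (λ s → proj₂ (off-full (false ∷ s) λ ())))

-- The expectation as a sum over subsets

prodSel : ∀ {k} → Vec Bool k → (Fin k → ℚ) → ℚ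
prodSel []          a = 1ℚ
prodSel (true ∷ s)  a = a zero * prodSel s (a ∘ suc)
prodSel (false ∷ s) a = prodSel s (a ∘ suc)

prodSel-1 : ∀ {k} (s : Vec Bool k) → prodSel s (λ _ → 1ℚ) ≡ 1ℚ
prodSel-1 []          = refl
prodSel-1 (true ∷ s)  = trans (ℚP.*-identityˡ _) (prodSel-1 s)
prodSel-1 (false ∷ s) = prodSel-1 s

binomial-expansion : ∀ k (a : Fin k → ℚ) c →
  prodℚ k (λ j → a j + c) ≡ sumSubsets k (λ s → powℚ c (#false s) * prodSel s a)
binomial-expansion zero    a c = refl
binomial-expansion (suc k) a c = begin
  (a zero + c) * prodℚ k (λ j → a (suc j) + c)
    ≡⟨ cong ((a zero + c) *_) (binomial-expansion k (a ∘ suc) c) ⟩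
  (a zero + c) * sumSubsets k G
    ≡⟨ ℚP.*-distribʳ-+ (sumSubsets k G) (a zero) c ⟩
  a zero * sumSubsets k G + c * sumSubsets k G
    ≡⟨ cong₂ _+_ (sym (sumSubsets-*ˡ k (a zero) G)) (sym (sumSubsets-*ˡ k c G)) ⟩
  sumSubsets k (λ s → a zero * G s) + sumSubsets k (λ s → c * G s)
    ≡⟨ cong₂ _+_ (sumSubsets-cong k λ s → solve 3 (λ x y z → x :* (y :* z) := y :* (x :* z)) refl
                                                 (a zero) (powℚ c (#false s)) (prodSel s (a ∘ suc)))
                 (sumSubsets-cong k λ s → sym (ℚP.*-assoc c (powℚ c (#false s)) _)) ⟩
  sumSubsets (suc k) (λ s → powℚ c (#false s) * prodSel s a) ∎
  where
    open ≡-Reasoning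
    G : Vec Bool k → ℚ
    G s = powℚ c (#false s) * prodSel s (a ∘ suc)

Y≡𝟙 : ∀ {m n} (M : Vec (Vec Bool n) m) v → Y M v ≡ 𝟙 (inCode M v)
Y≡𝟙 M v with inCode M v
... | true  = refl
... | false = refl

Y-∷ : ∀ {m n} r (M : Vec (Vec Bool n) m) v → Y (r ∷ M) v ≡ 𝟙 (not (dot r v)) * Y M v
Y-∷ r M v = begin
  Y (r ∷ M) v                          ≡⟨ Y≡𝟙 (r ∷ M) v ⟩
  𝟙 (inCode (r ∷ M) v)                 ≡⟨ cong 𝟙 (allL-∷ (λ row → not (dot row v)) r (Vec.toList M)) ⟩
  𝟙 (not (dot r v) ∧ inCode M v)       ≡⟨ 𝟙-∧ (not (dot r v)) (inCode M v) ⟩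
  𝟙 (not (dot r v)) * 𝟙 (inCode M v)   ≡⟨ cong (𝟙 (not (dot r v)) *_) (Y≡𝟙 M v) ⟨
  𝟙 (not (dot r v)) * Y M v            ∎
  where open ≡-Reasoning

module _ {n : ℕ} where

  prodSel-Y-∷ : ∀ {m k} (s : Vec Bool k) (u : Fin k → Vec Bool n) r (M : Vec (Vec Bool n) m) →
    prodSel s (λ j → Y (r ∷ M) (u j)) ≡ 𝟙 (orth (sel s u) r) * prodSel s (λ j → Y M (u j))
  prodSel-Y-∷ []          u r M = sym (ℚP.*-identityˡ 1ℚ)
  prodSel-Y-∷ (false ∷ s) u r M = prodSel-Y-∷ s (u ∘ suc) r M
  prodSel-Y-∷ (true ∷ s)  u r M = begin
    Y (r ∷ M) (u zero) * prodSel s (λ j → Y (r ∷ M) (u (suc j)))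
      ≡⟨ cong₂ _*_ (Y-∷ r M (u zero)) (prodSel-Y-∷ s (u ∘ suc) r M) ⟩
    (𝟙 a * Y M (u zero)) * (𝟙 b * rest)
      ≡⟨ *-interchange (𝟙 a) (Y M (u zero)) (𝟙 b) rest ⟩
    (𝟙 a * 𝟙 b) * (Y M (u zero) * rest)
      ≡⟨ cong (_* (Y M (u zero) * rest)) (𝟙-∧ a b) ⟨
    𝟙 (a ∧ b) * (Y M (u zero) * rest) ∎
    where
      open ≡-Reasoning
      a b : Bool
      a = not (dot r (u zero))
      b = orth (sel s (u ∘ suc)) r
      rest : ℚ
      rest = prodSel s (λ j → Y M (u (suc j)))

  ∑-prodSel-Y : ∀ m {k} (s : Vec Bool k) (u : Fin k → Vec Bool n) →
    ∑ (allMatrices m n) (λ M → prodSel s (λ j → Y M (u j))) ≡ powℚ (#⊥ (sel s u)) m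
  ∑-prodSel-Y m s u = ∑-allVecsOf-multiplicative (allBits n) (λ M → prodSel s (λ j → Y M (u j)))
    (λ r → 𝟙 (orth (sel s u) r)) (prodSel-1 s) (λ r M → prodSel-Y-∷ s u r M) m

  ker-probability : ∀ m (W : List (Vec Bool n)) → powℚ (#⊥ W) m * powℚ ½ (m ℕ.* n) ≡ powℚ (pr m) (ρ W)
  ker-probability m W = begin
    powℚ (#⊥ W) m * powℚ ½ (m ℕ.* n)          ≡⟨ cong (λ e → powℚ (#⊥ W) m * powℚ ½ e) (ℕP.*-comm m n) ⟩
    powℚ (#⊥ W) m * powℚ ½ (n ℕ.* m)          ≡⟨ cong (powℚ (#⊥ W) m *_) (powℚ-* ½ n m) ⟨
    powℚ (#⊥ W) m * powℚ (powℚ ½ n) m         ≡⟨ ℚP.*-comm (powℚ (#⊥ W) m) _ ⟩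
    powℚ (powℚ ½ n) m * powℚ (#⊥ W) m         ≡⟨ powℚ-distrib-* (powℚ ½ n) (#⊥ W) m ⟨
    powℚ (powℚ ½ n * #⊥ W) m                  ≡⟨ cong (λ q → powℚ q m) (density W) ⟩
    powℚ (powℚ ½ (ρ W)) m                     ≡⟨ powℚ-swap ½ (ρ W) m ⟩
    powℚ (pr m) (ρ W)                          ∎
    where open ≡-Reasoning

  -- The contribution of the subset s: (−p)^{k−|s|} times P(uⱼ ∈ C for all j ∈ s) = p^{r(s)}.
  term : ∀ {k} → ℚ → (Fin k → Vec Bool n) → Vec Bool k → ℚ
  term p u s = powℚ (- p) (#false s) * powℚ p (ρ (sel s u))

  expectation-expansion : ∀ m k (u : Fin k → Vec Bool n) → EprodZ m n k u ≡ sumSubsets k (term (pr m) u)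
  expectation-expansion m k u = begin
    ∑ AM (λ M → prodℚ k (λ j → Z M (u j))) * h
      ≡⟨ cong (_* h) (∑-cong AM λ M → binomial-expansion k (λ j → Y M (u j)) (- pr m)) ⟩
    ∑ AM (λ M → sumSubsets k (λ s → c s * prodSel s (λ j → Y M (u j)))) * h
      ≡⟨ cong (_* h) (∑-sumSubsets AM k (λ M s → c s * prodSel s (λ j → Y M (u j)))) ⟩
    sumSubsets k (λ s → ∑ AM (λ M → c s * prodSel s (λ j → Y M (u j)))) * h
      ≡⟨ cong (_* h) (sumSubsets-cong k λ s → trans (∑-*ˡ AM (c s) _) (cong (c s *_) (∑-prodSel-Y m s u))) ⟩
    sumSubsets k (λ s → c s * powℚ (#⊥ (sel s u)) m) * h
      ≡⟨ sumSubsets-*ʳ k h _ ⟨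
    sumSubsets k (λ s → c s * powℚ (#⊥ (sel s u)) m * h)
      ≡⟨ sumSubsets-cong k (λ s → trans (ℚP.*-assoc (c s) _ h) (cong (c s *_) (ker-probability m (sel s u)))) ⟩
    sumSubsets k (term (pr m) u) ∎
    where
      open ≡-Reasoning
      AM : List (Vec (Vec Bool n) m)
      AM = allMatrices m n
      h : ℚ
      h = powℚ ½ (m ℕ.* n)
      c : Vec Bool k → ℚ
      c s = powℚ (- pr m) (#false s)

  term-cancels : ∀ p k (u : Fin k → Vec Bool n) j → IsColoop k u j → ∀ s → lookup s j ≡ false →
                 term p u s + term p u (s [ j ]≔ true) ≡ 0ℚ
  term-cancels p k u j coloop s sⱼ = begin
    powℚ (- p) (#false s) * powℚ p (ρ (sel s u)) + powℚ (- p) (#false s′) * powℚ p (ρ (sel s′ u))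
      ≡⟨ cong₂ (λ f r → powℚ (- p) f * powℚ p (ρ (sel s u)) + powℚ (- p) (#false s′) * powℚ p r)
               (#false-insert s j sⱼ) ρ-s′ ⟩
    (- p * a) * b + a * (p * b)
      ≡⟨ solve 3 (λ p a b → (:- p :* a) :* b :+ a :* (p :* b) := con 0ℚ) refl p a b ⟩
    0ℚ ∎
    where
      open ≡-Reasoning
      s′ : Vec Bool k
      s′ = s [ j ]≔ true
      a b : ℚ
      a = powℚ (- p) (#false s′)
      b = powℚ p (ρ (sel s u))
      ρ-s′ : ρ (sel s′ u) ≡ suc (ρ (sel s u))
      ρ-s′ = trans (ρ-cong (sel s′ u) (u j ∷ sel s u) (orth-sel-insert k s u j sⱼ))
                   (ρ-∉span (sel s u) (u j) (coloop⇒∉span k u j coloop s sⱼ))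

  coloop⇒sum-vanishes : ∀ p k (u : Fin k → Vec Bool n) → HasColoop k u → sumSubsets k (term p u) ≡ 0ℚ
  coloop⇒sum-vanishes p k u (j , coloop) = sumSubsets-pairing k j (term p u) (term-cancels p k u j coloop)

module _ {n : ℕ} {p : ℚ} (0≤p : 0ℚ ≤ℚ p) (p≤1 : p ≤ℚ 1ℚ) where

  term-full : ∀ k (u : Fin k → Vec Bool n) → term p u (full k) ≡ powℚ p (ρ (sel (full k) u))
  term-full k u = trans (cong (λ f → powℚ (- p) f * powℚ p (ρ (sel (full k) u))) (#false-full k))
                        (ℚP.*-identityˡ _)

  term-off-full : ∀ k (u : Fin k → Vec Bool n) → ¬ HasColoop k u → ∀ s → s ≢ full k →
    - (p * powℚ p (ρ (sel (full k) u))) ≤ℚ term p u s × term p u s ≤ℚ p * powℚ p (ρ (sel (full k) u))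
  term-off-full k u no-coloop s s≢full = ±-within (powℚ-nonNeg 0≤p p≤1 (f ℕ.+ r)) small sign
    where
      f r : ℕ
      f = #false s
      r = ρ (sel s u)
      small : powℚ p (f ℕ.+ r) ≤ℚ p * powℚ p (ρ (sel (full k) u))
      small = powℚ-antitone 0≤p p≤1
                (subst (suc (ρ (sel (full k) u)) ≤_) (ℕP.+-comm r f) (rank-deficit k u no-coloop s s≢full))
      sign : term p u s ≡ powℚ p (f ℕ.+ r) ⊎ term p u s ≡ - powℚ p (f ℕ.+ r)
      sign with powℚ-neg p f
      ... | inj₁ eq = inj₁ (trans (cong (_* powℚ p r) eq) (sym (powℚ-+ p f r)))
      ... | inj₂ eq = inj₂ (trans (cong (_* powℚ p r) eq)
                          (trans (sym (ℚP.neg-distribˡ-* (powℚ p f) (powℚ p r))) (cong -_ (sym (powℚ-+ p f r)))))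

  no-coloop⇒sum-bounds : ∀ k (u : Fin k → Vec Bool n) → powℚ two k * p ≤ℚ ½ → ¬ HasColoop k u →
    ½ * powℚ p (ρ (sel (full k) u)) ≤ℚ sumSubsets k (term p u) ×
    sumSubsets k (term p u) ≤ℚ two * powℚ p (ρ (sel (full k) u))
  no-coloop⇒sum-bounds k u 2ᵏp≤½ no-coloop =
      ℚP.≤-trans half≤ (subst (λ t → t - c * (p * P) ≤ℚ Σt) (term-full k u) (proj₁ near))
    , ℚP.≤-trans (subst (λ t → Σt ≤ℚ t + c * (p * P)) (term-full k u) (proj₂ near)) ≤double
    where
      P c Σt : ℚ
      P  = powℚ p (ρ (sel (full k) u))
      c  = powℚ two k
      Σt = sumSubsets k (term p u)
      0≤P : 0ℚ ≤ℚ P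
      0≤P = powℚ-nonNeg 0≤p p≤1 (ρ (sel (full k) u))
      0≤pP : 0ℚ ≤ℚ p * P
      0≤pP = subst (_≤ℚ p * P) (ℚP.*-zeroʳ p) (ℚP.*-monoˡ-≤-nonNeg p {{nonNegative 0≤p}} 0≤P)
      near : term p u (full k) - c * (p * P) ≤ℚ Σt × Σt ≤ℚ term p u (full k) + c * (p * P)
      near = sumSubsets-near-full k (term p u) 0≤pP (term-off-full k u no-coloop)
      cpP≤½P : c * (p * P) ≤ℚ ½ * P
      cpP≤½P = subst (_≤ℚ ½ * P) (ℚP.*-assoc c p P) (ℚP.*-monoʳ-≤-nonNeg P {{nonNegative 0≤P}} 2ᵏp≤½)
      half≤ : ½ * P ≤ℚ P - c * (p * P)
      half≤ = subst (_≤ℚ P - c * (p * P)) (solve 1 (λ x → x :- con ½ :* x := con ½ :* x) refl P)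
                    (ℚP.+-monoʳ-≤ P (ℚP.neg-antimono-≤ cpP≤½P))
      ≤double : P + c * (p * P) ≤ℚ two * P
      ≤double = begin
        P + c * (p * P)   ≤⟨ ℚP.+-monoʳ-≤ P cpP≤½P ⟩
        P + ½ * P         ≤⟨ ℚP.+-monoʳ-≤ P (ℚP.*-monoʳ-≤-nonNeg P {{nonNegative 0≤P}} (ℚP.<⇒≤ ½<1)) ⟩
        P + 1ℚ * P        ≡⟨ solve 1 (λ x → x :+ con 1ℚ :* x := (con 1ℚ :+ con 1ℚ) :* x) refl P ⟩
        two * P           ∎
        where open ℚP.≤-Reasoning

two^k*½^m≤½ : ∀ {k m} → k < m → powℚ two k * powℚ ½ m ≤ℚ ½
two^k*½^m≤½ {k} {m} k<m = begin
  powℚ two k * powℚ ½ m                       ≡⟨ cong (λ e → powℚ two k * powℚ ½ e) (ℕP.m+[n∸m]≡n k<m) ⟨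
  powℚ two k * powℚ ½ (suc k ℕ.+ d)           ≡⟨ cong (powℚ two k *_) (powℚ-+ ½ (suc k) d) ⟩
  powℚ two k * ((½ * powℚ ½ k) * powℚ ½ d)
    ≡⟨ solve 3 (λ t h e → t :* ((con ½ :* h) :* e) := (h :* t) :* (con ½ :* e)) refl
               (powℚ two k) (powℚ ½ k) (powℚ ½ d) ⟩
  (powℚ ½ k * powℚ two k) * (½ * powℚ ½ d)    ≡⟨ cong (_* (½ * powℚ ½ d)) (powℚ-½*two k) ⟩
  1ℚ * (½ * powℚ ½ d)                         ≡⟨ ℚP.*-identityˡ _ ⟩
  ½ * powℚ ½ d                                ≤⟨ ℚP.*-monoˡ-≤-nonNeg ½ {{nonNegative (ℚP.<⇒≤ 0<½)}}
                                                   (powℚ-≤1 (ℚP.<⇒≤ 0<½) (ℚP.<⇒≤ ½<1) d) ⟩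
  ½ * 1ℚ                                      ≡⟨ ℚP.*-identityʳ ½ ⟩
  ½                                           ∎
  where
    open ℚP.≤-Reasoning
    d : ℕ
    d = m ℕ.∸ suc k

lemma3p2 : (n m k : ℕ) → 1 ≤ n → 1 ≤ m → k ≤ m Data.Nat.∸ 1 → (u : Fin k → Vec Bool n) →
    ((¬ HasColoop k u) →
      (½ * powℚ (pr m) (rank k u) ≤ℚ EprodZ m n k u)
        × (EprodZ m n k u ≤ℚ (1ℚ + 1ℚ) * powℚ (pr m) (rank k u)))
    × (HasColoop k u → EprodZ m n k u ≡ 0ℚ)
lemma3p2 n zero      k _ () _ u
lemma3p2 n (suc m′) k _ _ k≤m′ u rewrite expectation-expansion (suc m′) k u | rank≡ρ k u =
    no-coloop⇒sum-bounds 0≤p p≤1 k u (two^k*½^m≤½ (s≤s k≤m′))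
  , coloop⇒sum-vanishes (pr (suc m′)) k u
  where
    0≤p : 0ℚ ≤ℚ pr (suc m′)
    0≤p = powℚ-nonNeg (ℚP.<⇒≤ 0<½) (ℚP.<⇒≤ ½<1) (suc m′)
    p≤1 : pr (suc m′) ≤ℚ 1ℚ
    p≤1 = powℚ-≤1 (ℚP.<⇒≤ 0<½) (ℚP.<⇒≤ ½<1) (suc m′)
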